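{- Let $\mathcal T$ be the rooted labelled tree whose root (at level $0$) has label $(1,0)$, and in which every node with label $(a,b)$ has exactly $b$ children labelled $(a+1,b-1)$ and, for each $j\in\{1,\dots,a\}$, one child labelled $(a+1-j,\,b+j)$ (and no other children); children of a node at level $n$ are at level $n+1$. Then for every $n\geqslant 0$, the number of nodes of $\mathcal T$ at level $n$ equals $|\mathcal{I}_n(000,100)|$.
   Context: For $n\in\mathbb N$, an inversion sequence of size $n$ is a sequence $\sigma=(\sigma_1,\dots,\sigma_n)\in\mathbb N^n$ with $\sigma_i<i$ for all $i$. An integer sequence contains a pattern $\rho$ (a finite integer sequence such as $000$ or $100$) if it has a subsequence order-isomorphic to $\rho$, and avoids $\rho$ otherwise. $\mathcal{I}_n(P)$ denotes the set of inversion sequences of size $n$ avoiding every pattern in the set $P$. -}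

module Defs where

open import Data.Nat using (ℕ; zero; suc; _+_; _∸_; _<_; _≤_)
open import Data.Fin using (Fin; toℕ) renaming (_<_ to _<ᶠ_)
open import Data.List using (List; []; _∷_; length; lookup; replicate; map; concatMap; _++_; upTo)
open import Data.Product using (_×_; _,_; Σ; ∃)
open import Relation.Nullary using (¬_)
open import Relation.Binary.PropositionalEquality using (_≡_)
open import Function.Bundles using (_⇔_)

Label : Set
Label = ℕ × ℕ

children : Label → List Label
children (a , b) =
  replicate b (suc a , b ∸ 1) ++ map (λ j → (suc a ∸ j , b + j)) (map suc (upTo a))

level : ℕ → List Label
level zero    = (1 , 0) ∷ []
level (suc n) = concatMap children (level n)

-- Inversion sequences and pattern avoidance
-- Sequences are lists; the 0-based position i corresponds to the 1-based
-- index i+1, so σ_{i+1} < i+1 is  lookup σ i < suc (toℕ i).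

IsInversionSequence : ℕ → List ℕ → Set
IsInversionSequence n σ =
  (length σ ≡ n) × (∀ (i : Fin (length σ)) → lookup σ i < suc (toℕ i))

Contains : List ℕ → List ℕ → Set
Contains σ ρ =
  Σ (Fin (length ρ) → Fin (length σ)) λ f →
    (∀ p q → p <ᶠ q → f p <ᶠ f q) ×
    (∀ p q → (lookup ρ p < lookup ρ q) ⇔ (lookup σ (f p) < lookup σ (f q)))

Avoids : List ℕ → List ℕ → Set
Avoids σ ρ = ¬ Contains σ ρ

p000 : List ℕ
p000 = 0 ∷ 0 ∷ 0 ∷ []

p100 : List ℕ
p100 = 1 ∷ 0 ∷ 0 ∷ []

InI-000-100 : ℕ → List ℕ → Set
InI-000-100 n σ = IsInversionSequence n σ × Avoids σ p000 × Avoids σ p100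

module Submission where

-- A sequence contains 000 or 100 iff it has entries σᵢ, σⱼ, σₖ (i < j < k) with σⱼ ≤ σᵢ and
-- σⱼ = σₖ. Grow the sequences of 𝓘ₙ(000,100) by appending one entry at a time and record, for
-- each, its maximum M (M = -1 for the empty sequence) and the set F of values v ≤ M that can be
-- appended without creating such a triple; every value M < v ≤ n can be appended. Appending
-- x ∈ F keeps M and removes exactly x from F (an earlier entry ≥ x exists); appending M + j with
-- 1 ≤ j ≤ n - M adds M + 1, …, M + j to F, as no earlier entry is that large. Hence the labels
-- (n - M, |F|) follow the rules of 𝒯, and the sequences of length n correspond to the nodes
-- at level n.

open import Defs
open import Data.Nat using (ℕ; zero; suc; _+_; _∸_; _<_; _≤_; z≤n; s≤s; s≤s⁻¹; _≟_; _<?_)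
open import Data.Nat.Properties
open import Data.Fin using (Fin; toℕ) renaming (zero to fzero; suc to fsuc; _<_ to _<ᶠ_)
open import Data.List using (List; []; _∷_; length; lookup; _∷ʳ_; _++_; map; concat; concatMap; upTo; filter; replicate; initLast; _∷ʳ′_)
open import Data.List.Properties using (length-++; length-map; length-upTo; map-++; map-∘; map-cong; map-cong-local; map-concatMap; concatMap-map; concatMap-cong; ∷ʳ-injective; filter-all; filter-accept; filter-reject)
open import Data.List.Relation.Unary.Any as Any using (Any; here; there)
open import Data.List.Relation.Unary.Any.Properties using (++⁺ˡ; ++⁺ʳ; ++⁻; singleton⁻; lookup-index)
open import Data.List.Relation.Unary.All as All using (All; []; _∷_)
import Data.List.Relation.Unary.All.Properties as All
open import Data.List.Relation.Unary.AllPairs as AllPairs using ([]; _∷_)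
import Data.List.Relation.Unary.AllPairs.Properties as AllPairs
open import Data.List.Relation.Unary.Unique.Propositional using (Unique)
import Data.List.Relation.Unary.Unique.Propositional.Properties as Unique
open import Data.List.Relation.Binary.Disjoint.Propositional using (Disjoint)
open import Data.List.Membership.Propositional using (_∈_; lose; find)
open import Data.List.Membership.Propositional.Properties using (∈-lookup; ∈-map⁺; ∈-map⁻; ∈-++⁺ˡ; ∈-++⁺ʳ; ∈-++⁻; ∈-upTo⁺; ∈-upTo⁻; ∈-filter⁺; ∈-filter⁻; ∈-concatMap⁺; ∈-concatMap⁻)
open import Data.Product using (Σ; ∃₂; _×_; _,_; proj₁; proj₂)
open import Data.Sum as Sum using (_⊎_; inj₁; inj₂; [_,_]′)
open import Data.Unit using (⊤; tt)
open import Function using (_∘_)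
open import Function.Bundles using (_⇔_; mk⇔; Equivalence)
open import Relation.Binary.Definitions using (tri<; tri≈; tri>)
open import Relation.Binary.PropositionalEquality using (_≡_; _≢_; refl; sym; trans; cong; cong₂; subst; subst₂; module ≡-Reasoning)
open import Relation.Nullary using (¬_; ¬?; yes; no; contradiction)

open Equivalence using (to; from)

module _ {A : Set} where

  data Any₂ (R : A → A → Set) : List A → Set where
    here  : ∀ {x xs} → Any (R x) xs → Any₂ R (x ∷ xs)
    there : ∀ {x xs} → Any₂ R xs → Any₂ R (x ∷ xs)

  data Any₃ (T : A → A → A → Set) : List A → Set where
    here  : ∀ {x xs} → Any₂ (T x) xs → Any₃ T (x ∷ xs)
    there : ∀ {x xs} → Any₃ T xs → Any₃ T (x ∷ xs)

  lookup⇒Any₂ : ∀ {R} xs {i j : Fin (length xs)} → i <ᶠ j →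
                R (lookup xs i) (lookup xs j) → Any₂ R xs
  lookup⇒Any₂ (x ∷ xs) {fzero}  {fzero}  ()
  lookup⇒Any₂ (x ∷ xs) {fzero}  {fsuc j} _         r = here (lose (∈-lookup j) r)
  lookup⇒Any₂ (x ∷ xs) {fsuc i} {fzero}  ()
  lookup⇒Any₂ (x ∷ xs) {fsuc i} {fsuc j} (s≤s i<j) r = there (lookup⇒Any₂ xs i<j r)

  lookup⇒Any₃ : ∀ {T} xs {i j k : Fin (length xs)} → i <ᶠ j → j <ᶠ k →
                T (lookup xs i) (lookup xs j) (lookup xs k) → Any₃ T xs
  lookup⇒Any₃ (x ∷ xs) {fzero}  {fzero}  ()
  lookup⇒Any₃ (x ∷ xs) {fsuc i} {fzero}  ()
  lookup⇒Any₃ (x ∷ xs) {fzero}  {fsuc j} {fzero}  _ ()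
  lookup⇒Any₃ (x ∷ xs) {fsuc i} {fsuc j} {fzero}  _ ()
  lookup⇒Any₃ (x ∷ xs) {fzero}  {fsuc j} {fsuc k} _ (s≤s j<k) t = here (lookup⇒Any₂ xs j<k t)
  lookup⇒Any₃ (x ∷ xs) {fsuc i} {fsuc j} {fsuc k} (s≤s i<j) (s≤s j<k) t =
    there (lookup⇒Any₃ xs i<j j<k t)

  Any₂⇒lookup : ∀ {R xs} → Any₂ R xs →
                ∃₂ λ i j → i <ᶠ j × R (lookup xs i) (lookup xs j)
  Any₂⇒lookup (here p)  = fzero , fsuc (Any.index p) , s≤s z≤n , lookup-index p
  Any₂⇒lookup (there p) = let i , j , i<j , r = Any₂⇒lookup p in fsuc i , fsuc j , s≤s i<j , r

  Any₃⇒lookup : ∀ {T xs} → Any₃ T xs →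
                ∃₂ λ i j → Σ (Fin (length xs)) λ k →
                  i <ᶠ j × j <ᶠ k × T (lookup xs i) (lookup xs j) (lookup xs k)
  Any₃⇒lookup (here p)  = let j , k , j<k , t = Any₂⇒lookup p in
    fzero , fsuc j , fsuc k , s≤s z≤n , s≤s j<k , t
  Any₃⇒lookup (there p) = let i , j , k , i<j , j<k , t = Any₃⇒lookup p in
    fsuc i , fsuc j , fsuc k , s≤s i<j , s≤s j<k , t

  Any₂-∷ʳ⁻ : ∀ {R} xs {y} → Any₂ R (xs ∷ʳ y) → Any₂ R xs ⊎ Any (λ x → R x y) xs
  Any₂-∷ʳ⁻ []       (here ())
  Any₂-∷ʳ⁻ []       (there ())
  Any₂-∷ʳ⁻ (x ∷ xs) (here p)  = Sum.map here (here ∘ singleton⁻) (++⁻ xs p)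
  Any₂-∷ʳ⁻ (x ∷ xs) (there p) = Sum.map there there (Any₂-∷ʳ⁻ xs p)

  Any₂-∷ʳ⁺ˡ : ∀ {R xs y} → Any₂ R xs → Any₂ R (xs ∷ʳ y)
  Any₂-∷ʳ⁺ˡ (here p)  = here (++⁺ˡ p)
  Any₂-∷ʳ⁺ˡ (there p) = there (Any₂-∷ʳ⁺ˡ p)

  Any₂-∷ʳ⁺ʳ : ∀ {R} xs {y} → Any (λ x → R x y) xs → Any₂ R (xs ∷ʳ y)
  Any₂-∷ʳ⁺ʳ (x ∷ xs) (here r)  = here (++⁺ʳ xs (here r))
  Any₂-∷ʳ⁺ʳ (x ∷ xs) (there p) = there (Any₂-∷ʳ⁺ʳ xs p)

  Any₃-∷ʳ⁻ : ∀ {T} xs {z} → Any₃ T (xs ∷ʳ z) → Any₃ T xs ⊎ Any₂ (λ x y → T x y z) xs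
  Any₃-∷ʳ⁻ []       (here ())
  Any₃-∷ʳ⁻ []       (there ())
  Any₃-∷ʳ⁻ (x ∷ xs) (here p)  = Sum.map here here (Any₂-∷ʳ⁻ xs p)
  Any₃-∷ʳ⁻ (x ∷ xs) (there p) = Sum.map there there (Any₃-∷ʳ⁻ xs p)

  Any₃-∷ʳ⁺ˡ : ∀ {T xs z} → Any₃ T xs → Any₃ T (xs ∷ʳ z)
  Any₃-∷ʳ⁺ˡ (here p)  = here (Any₂-∷ʳ⁺ˡ p)
  Any₃-∷ʳ⁺ˡ (there p) = there (Any₃-∷ʳ⁺ˡ p)

  Any₃-∷ʳ⁺ʳ : ∀ {T} xs {z} → Any₂ (λ x y → T x y z) xs → Any₃ T (xs ∷ʳ z)
  Any₃-∷ʳ⁺ʳ (x ∷ xs) (here p)  = here (Any₂-∷ʳ⁺ʳ xs p)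
  Any₃-∷ʳ⁺ʳ (x ∷ xs) (there p) = there (Any₃-∷ʳ⁺ʳ xs p)

strictMono⇒reflects : ∀ {h : ℕ → ℕ} → (∀ {u v} → u < v → h u < h v) →
                      ∀ {u v} → h u < h v → u < v
strictMono⇒reflects mono {u} {v} hu<hv with <-cmp u v
... | tri< u<v _ _ = u<v
... | tri≈ _ refl _ = contradiction hu<hv (<-irrefl refl)
... | tri> _ _ v<u = contradiction hu<hv (<⇒≯ (mono v<u))

strictMonoImage⇒Contains : ∀ σ ρ (f : Fin (length ρ) → Fin (length σ)) (h : ℕ → ℕ) →
  (∀ p q → p <ᶠ q → f p <ᶠ f q) → (∀ {u v} → u < v → h u < h v) →
  (∀ p → lookup σ (f p) ≡ h (lookup ρ p)) → Contains σ ρ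
strictMonoImage⇒Contains σ ρ f h f-mono h-mono values = f , f-mono , λ p q → mk⇔
  (λ lt → subst₂ _<_ (sym (values p)) (sym (values q)) (h-mono lt))
  (λ lt → strictMono⇒reflects h-mono (subst₂ _<_ (values p) (values q) lt))

module _ {n} {i j k : Fin n} (i<j : i <ᶠ j) (j<k : j <ᶠ k) where

  triple : Fin 3 → Fin n
  triple fzero               = i
  triple (fsuc fzero)        = j
  triple (fsuc (fsuc fzero)) = k

  triple-mono : ∀ p q → p <ᶠ q → triple p <ᶠ triple q
  triple-mono fzero               (fsuc fzero)        _ = i<j
  triple-mono fzero               (fsuc (fsuc fzero)) _ = <-trans i<j j<k
  triple-mono (fsuc fzero)        (fsuc (fsuc fzero)) _ = j<k
  triple-mono fzero               fzero               ()
  triple-mono (fsuc fzero)        fzero               ()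
  triple-mono (fsuc fzero)        (fsuc fzero)        (s≤s ())
  triple-mono (fsuc (fsuc fzero)) fzero               ()
  triple-mono (fsuc (fsuc fzero)) (fsuc fzero)        (s≤s ())
  triple-mono (fsuc (fsuc fzero)) (fsuc (fsuc fzero)) (s≤s (s≤s ()))

-- σᵢ σⱼ σₖ with σⱼ ≤ σᵢ and σⱼ = σₖ is an occurrence of 000 (if σⱼ = σᵢ) or of 100 (if σⱼ < σᵢ).
Forbidden : ℕ → ℕ → ℕ → Set
Forbidden a b c = b ≤ a × b ≡ c

Forbidden⇒Contains : ∀ σ {i j k} → i <ᶠ j → j <ᶠ k →
  Forbidden (lookup σ i) (lookup σ j) (lookup σ k) → Contains σ p000 ⊎ Contains σ p100
Forbidden⇒Contains σ {i} {j} {k} i<j j<k (b≤a , b≡c) with m≤n⇒m<n∨m≡n b≤a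
... | inj₂ b≡a = inj₁ (strictMonoImage⇒Contains σ p000 (triple i<j j<k) (_+ lookup σ j)
                         (triple-mono i<j j<k) (+-monoˡ-< (lookup σ j)) values)
  where
  values : ∀ p → lookup σ (triple i<j j<k p) ≡ lookup p000 p + lookup σ j
  values fzero               = sym b≡a
  values (fsuc fzero)        = refl
  values (fsuc (fsuc fzero)) = sym b≡c
... | inj₁ b<a = inj₂ (strictMonoImage⇒Contains σ p100 (triple i<j j<k) h
                         (triple-mono i<j j<k) h-mono values)
  where
  h : ℕ → ℕ
  h zero    = lookup σ j
  h (suc u) = u + lookup σ i
  h-mono : ∀ {u v} → u < v → h u < h v
  h-mono {zero}  {suc v} _         = <-≤-trans b<a (m≤n+m _ v)
  h-mono {suc u} {suc v} (s≤s u<v) = +-monoˡ-< _ u<v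
  values : ∀ p → lookup σ (triple i<j j<k p) ≡ h (lookup p100 p)
  values fzero               = refl
  values (fsuc fzero)        = refl
  values (fsuc (fsuc fzero)) = sym b≡c

Contains⇒Any₃ : ∀ {x y} σ → ¬ x < y → Contains σ (x ∷ y ∷ y ∷ []) → Any₃ Forbidden σ
Contains⇒Any₃ σ x≮y (f , f-mono , iso) =
  lookup⇒Any₃ σ (f-mono fzero p₁ (s≤s z≤n)) (f-mono p₁ p₂ (s≤s (s≤s z≤n)))
    ( ≮⇒≥ (x≮y ∘ from (iso fzero p₁))
    , ≤-antisym (≮⇒≥ (<-irrefl refl ∘ from (iso p₂ p₁))) (≮⇒≥ (<-irrefl refl ∘ from (iso p₁ p₂))))
  where
  p₁ p₂ : Fin 3
  p₁ = fsuc fzero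
  p₂ = fsuc (fsuc fzero)

avoids⇔ : ∀ σ → (Avoids σ p000 × Avoids σ p100) ⇔ (¬ Any₃ Forbidden σ)
avoids⇔ σ = mk⇔
  (λ (avoids₀ , avoids₁) occ →
     let _ , _ , _ , i<j , j<k , t = Any₃⇒lookup occ in
     [ avoids₀ , avoids₁ ]′ (Forbidden⇒Contains σ i<j j<k t))
  (λ ¬occ → ¬occ ∘ Contains⇒Any₃ σ (λ ()) , ¬occ ∘ Contains⇒Any₃ σ (λ ()))

Bounded : ℕ → List ℕ → Set
Bounded k []       = ⊤
Bounded k (y ∷ ys) = y < suc k × Bounded (suc k) ys

Bounded⇒lookup : ∀ k σ → Bounded k σ → ∀ i → lookup σ i < suc (toℕ i + k)
Bounded⇒lookup k (y ∷ ys) (y<  , _)  fzero    = y<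
Bounded⇒lookup k (y ∷ ys) (_   , ys<) (fsuc i) =
  subst (λ z → lookup ys i < suc z) (+-suc (toℕ i) k) (Bounded⇒lookup (suc k) ys ys< i)

lookup⇒Bounded : ∀ k σ → (∀ i → lookup σ i < suc (toℕ i + k)) → Bounded k σ
lookup⇒Bounded k []       _ = tt
lookup⇒Bounded k (y ∷ ys) σ< = σ< fzero , lookup⇒Bounded (suc k) ys
  (λ i → subst (λ z → lookup ys i < suc z) (sym (+-suc (toℕ i) k)) (σ< (fsuc i)))

Bounded-∷ʳ⁺ : ∀ k τ x → Bounded k τ → x < suc (length τ + k) → Bounded k (τ ∷ʳ x)
Bounded-∷ʳ⁺ k []       x _          x< = x< , tt
Bounded-∷ʳ⁺ k (y ∷ ys) x (y< , ys<) x< =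
  y< , Bounded-∷ʳ⁺ (suc k) ys x ys< (subst (λ z → x < suc z) (sym (+-suc (length ys) k)) x<)

Bounded-∷ʳ⁻ : ∀ k τ x → Bounded k (τ ∷ʳ x) → Bounded k τ × x < suc (length τ + k)
Bounded-∷ʳ⁻ k []       x (x< , _)   = tt , x<
Bounded-∷ʳ⁻ k (y ∷ ys) x (y< , ys<) =
  let ys< , x< = Bounded-∷ʳ⁻ (suc k) ys x ys< in
  (y< , ys<) , subst (λ z → x < suc z) (+-suc (length ys) k) x<

IsInversionSequence⇔Bounded : ∀ n σ → IsInversionSequence n σ ⇔ (length σ ≡ n × Bounded 0 σ)
IsInversionSequence⇔Bounded n σ = mk⇔
  (λ (len , σ<) → len , lookup⇒Bounded 0 σ (λ i → subst (λ z → lookup σ i < suc z) (sym (+-identityʳ _)) (σ< i)))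
  (λ (len , σ<) → len , λ i → subst (λ z → lookup σ i < suc z) (+-identityʳ _) (Bounded⇒lookup 0 σ σ< i))

length-∷ʳ : ∀ (τ : List ℕ) x → length (τ ∷ʳ x) ≡ suc (length τ)
length-∷ʳ τ x = trans (length-++ τ) (+-comm (length τ) 1)

IsInversionSequence-∷ʳ : ∀ n τ x →
  IsInversionSequence (suc n) (τ ∷ʳ x) ⇔ (IsInversionSequence n τ × x < suc n)
IsInversionSequence-∷ʳ n τ x = mk⇔
  (λ inv → let len , τx< = to (IsInversionSequence⇔Bounded (suc n) (τ ∷ʳ x)) inv
               len′ = suc-injective (trans (sym (length-∷ʳ τ x)) len)
               τ< , x< = Bounded-∷ʳ⁻ 0 τ x τx< in
           from (IsInversionSequence⇔Bounded n τ) (len′ , τ<) , subst (λ z → x < suc z) (trans (+-identityʳ _) len′) x<)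
  (λ (inv , x<) → let len , τ< = to (IsInversionSequence⇔Bounded n τ) inv in
     from (IsInversionSequence⇔Bounded (suc n) (τ ∷ʳ x))
       (trans (length-∷ʳ τ x) (cong suc len) , Bounded-∷ʳ⁺ 0 τ x τ< (subst (λ z → x < suc z) (sym (trans (+-identityʳ _) len)) x<)))

Good : ℕ → List ℕ → Set
Good n σ = IsInversionSequence n σ × ¬ Any₃ Forbidden σ

InI⇔Good : ∀ n σ → InI-000-100 n σ ⇔ Good n σ
InI⇔Good n σ = mk⇔ (λ (inv , avoids) → inv , to (avoids⇔ σ) avoids)
                   (λ (inv , ¬occ) → inv , from (avoids⇔ σ) ¬occ)

Completes : List ℕ → ℕ → Set
Completes τ v = Any₂ (λ a b → Forbidden a b v) τ

Good-∷ʳ : ∀ n τ x → Good (suc n) (τ ∷ʳ x) ⇔ (Good n τ × x < suc n × ¬ Completes τ x)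
Good-∷ʳ n τ x = mk⇔
  (λ (inv , ¬occ) → let invτ , x< = to (IsInversionSequence-∷ʳ n τ x) inv in
     (invτ , ¬occ ∘ Any₃-∷ʳ⁺ˡ) , x< , ¬occ ∘ Any₃-∷ʳ⁺ʳ τ)
  (λ ((invτ , ¬occ) , x< , ¬completes) →
     from (IsInversionSequence-∷ʳ n τ x) (invτ , x<) , [ ¬occ , ¬completes ]′ ∘ Any₃-∷ʳ⁻ τ)

Completes⇒∈ : ∀ {τ v} → Completes τ v → v ∈ τ
Completes⇒∈ (here p)  = there (Any.map (sym ∘ proj₂) p)
Completes⇒∈ (there p) = there (Completes⇒∈ p)

Completes-∷ʳ⁻ : ∀ τ {x v} → Completes (τ ∷ʳ x) v → Completes τ v ⊎ (x ≡ v × Any (x ≤_) τ)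
Completes-∷ʳ⁻ τ c with Any₂-∷ʳ⁻ τ c
... | inj₁ c′ = inj₁ c′
... | inj₂ p  = let _ , a∈τ , x≤a , x≡v = find p in inj₂ (x≡v , lose a∈τ x≤a)

Completes-∷ʳ⁺ʳ : ∀ τ {x} → Any (x ≤_) τ → Completes (τ ∷ʳ x) x
Completes-∷ʳ⁺ʳ τ p = Any₂-∷ʳ⁺ʳ τ (Any.map (_, refl) p)

interval : ℕ → ℕ → List ℕ
interval m k = map (m +_) (upTo k)

∈-interval⁻ : ∀ {m k v} → v ∈ interval m k → m ≤ v × v < m + k
∈-interval⁻ {m} v∈ with j , j∈ , refl ← ∈-map⁻ (m +_) v∈ = m≤m+n m j , +-monoʳ-< m (∈-upTo⁻ j∈)

∈-interval⁺ : ∀ {m k v} → m ≤ v → v < m + k → v ∈ interval m k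
∈-interval⁺ {m} {k} {v} m≤v v<m+k = subst (_∈ interval m k) (m+[n∸m]≡n m≤v)
  (∈-map⁺ (m +_) (∈-upTo⁺ (+-cancelˡ-< m _ _ (subst (_< m + k) (sym (m+[n∸m]≡n m≤v)) v<m+k))))

interval-unique : ∀ m k → Unique (interval m k)
interval-unique m k = Unique.map⁺ (+-cancelˡ-≡ m _ _) (Unique.upTo⁺ k)

length-interval : ∀ m k → length (interval m k) ≡ k
length-interval m k = trans (length-map (m +_) (upTo k)) (length-upTo k)

remove : ℕ → List ℕ → List ℕ
remove x = filter (λ y → ¬? (y ≟ x))

length-remove : ∀ {x xs} → Unique xs → x ∈ xs → suc (length (remove x xs)) ≡ length xs
length-remove {x} (x∉xs ∷ _) (here refl) = cong (suc ∘ length)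
  (trans (filter-reject (λ y → ¬? (y ≟ x)) (λ x≢x → x≢x refl)) (filter-all (λ y → ¬? (y ≟ x)) (All.map (_∘ sym) x∉xs)))
length-remove {x} {y ∷ ys} (y∉ys ∷ unique) (there x∈ys) =
  trans (cong (suc ∘ length) (filter-accept (λ z → ¬? (z ≟ x)) {y} {ys} (λ { refl → All.lookup y∉ys x∈ys refl })))
        (cong suc (length-remove unique x∈ys))

-- bound is one more than the largest entry of seq (0 for the empty sequence), free lists
-- the values below bound that can be appended to seq, and (n + 1 ∸ bound , length free)
-- is the label of the node.
record State : Set where
  constructor state
  field
    seq   : List ℕ
    bound : ℕ
    free  : List ℕ
open State

appendFree : State → ℕ → State
appendFree s x = state (seq s ∷ʳ x) (bound s) (remove x (free s))

appendNew : State → ℕ → State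
appendNew s j = state (seq s ∷ʳ (bound s + j)) (suc (bound s + j)) (free s ++ interval (bound s) (suc j))

childStates : ℕ → State → List State
childStates n s = map (appendFree s) (free s) ++ map (appendNew s) (upTo (suc n ∸ bound s))

levelStates : ℕ → List State
levelStates zero    = state [] 0 [] ∷ []
levelStates (suc n) = concatMap (childStates n) (levelStates n)

record WellFormed (n : ℕ) (s : State) : Set where
  field
    below     : All (_< bound s) (seq s)
    dominated : ∀ {v} → v < bound s → Any (v ≤_) (seq s)
    bound≤n   : bound s ≤ n
    unique    : Unique (free s)
    ∈-free    : ∀ {v} → v ∈ free s ⇔ (v < bound s × ¬ Completes (seq s) v)

Completes⇒< : ∀ {m τ v} → All (_< m) τ → Completes τ v → v < m
Completes⇒< τ<m c = All.lookup τ<m (Completes⇒∈ c)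

Completes-∷ʳ-large : ∀ {m x v} τ → All (_< m) τ → m ≤ x → Completes (τ ∷ʳ x) v → Completes τ v
Completes-∷ʳ-large τ τ<m m≤x c with Completes-∷ʳ⁻ τ c
... | inj₁ c′ = c′
... | inj₂ (_ , p) = let _ , a∈τ , x≤a = find p in
  contradiction (≤-trans m≤x x≤a) (<⇒≱ (All.lookup τ<m a∈τ))

module _ {n s} (wf : WellFormed n s) where
  open WellFormed wf

  free-interval-disjoint : ∀ k → Disjoint (free s) (interval (bound s) k)
  free-interval-disjoint k (v∈free , v∈interval) =
    <⇒≱ (proj₁ (to ∈-free v∈free)) (proj₁ (∈-interval⁻ v∈interval))

  appendFree-wf : ∀ {x} → x ∈ free s → WellFormed (suc n) (appendFree s x)
  appendFree-wf {x} x∈free = record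
    { below     = All.++⁺ below (x<bound ∷ [])
    ; dominated = ++⁺ˡ ∘ dominated
    ; bound≤n   = m≤n⇒m≤1+n bound≤n
    ; unique    = Unique.filter⁺ (λ y → ¬? (y ≟ x)) unique
    ; ∈-free    = mk⇔ ∈-remove⇒ ⇒∈-remove
    }
    where
    x<bound = proj₁ (to ∈-free x∈free)

    ∈-remove⇒ : ∀ {v} → v ∈ remove x (free s) → v < bound s × ¬ Completes (seq s ∷ʳ x) v
    ∈-remove⇒ v∈ =
      let v∈free , v≢x = ∈-filter⁻ (λ y → ¬? (y ≟ x)) v∈
          v<bound , ¬completes = to ∈-free v∈free in
      v<bound , [ ¬completes , (λ (x≡v , _) → v≢x (sym x≡v)) ]′ ∘ Completes-∷ʳ⁻ (seq s)

    ⇒∈-remove : ∀ {v} → v < bound s × ¬ Completes (seq s ∷ʳ x) v → v ∈ remove x (free s)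
    ⇒∈-remove (v<bound , ¬completes) = ∈-filter⁺ (λ y → ¬? (y ≟ x))
      (from ∈-free (v<bound , ¬completes ∘ Any₂-∷ʳ⁺ˡ))
      (λ { refl → ¬completes (Completes-∷ʳ⁺ʳ (seq s) (dominated x<bound)) })

  appendNew-wf : ∀ {j} → j < suc n ∸ bound s → WellFormed (suc n) (appendNew s j)
  appendNew-wf {j} j< = record
    { below     = All.++⁺ (All.map (λ y< → <-≤-trans y< (m≤n⇒m≤1+n bound≤x)) below) (≤-refl ∷ [])
    ; dominated = λ v<x+1 → ++⁺ʳ (seq s) (here (s≤s⁻¹ v<x+1))
    ; bound≤n   = x<n+1
    ; unique    = Unique.++⁺ unique (interval-unique (bound s) (suc j)) (free-interval-disjoint (suc j))
    ; ∈-free    = mk⇔ ∈-free′⇒ ⇒∈-free′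
    }
    where
    x = bound s + j
    bound≤x = m≤m+n (bound s) j
    x<n+1 : x < suc n
    x<n+1 = subst (x <_) (m+[n∸m]≡n (m≤n⇒m≤1+n bound≤n)) (+-monoʳ-< (bound s) j<)

    ∈-free′⇒ : ∀ {v} → v ∈ free s ++ interval (bound s) (suc j) → v < suc x × ¬ Completes (seq s ∷ʳ x) v
    ∈-free′⇒ {v} v∈ with ∈-++⁻ (free s) v∈
    ... | inj₁ v∈free = let v<bound , ¬completes = to ∈-free v∈free in
      <-≤-trans v<bound (m≤n⇒m≤1+n bound≤x) , ¬completes ∘ Completes-∷ʳ-large (seq s) below bound≤x
    ... | inj₂ v∈interval = let bound≤v , v< = ∈-interval⁻ v∈interval in
      subst (v <_) (+-suc (bound s) j) v< ,
      λ c → <⇒≱ (Completes⇒< below (Completes-∷ʳ-large (seq s) below bound≤x c)) bound≤v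

    ⇒∈-free′ : ∀ {v} → v < suc x × ¬ Completes (seq s ∷ʳ x) v → v ∈ free s ++ interval (bound s) (suc j)
    ⇒∈-free′ {v} (v< , ¬completes) with v <? bound s
    ... | yes v<bound = ∈-++⁺ˡ (from ∈-free (v<bound , ¬completes ∘ Any₂-∷ʳ⁺ˡ))
    ... | no  v≮bound = ∈-++⁺ʳ (free s) (∈-interval⁺ (≮⇒≥ v≮bound) (subst (v <_) (sym (+-suc (bound s) j)) v<))

  childStates-wf : All (WellFormed (suc n)) (childStates n s)
  childStates-wf = All.++⁺ (All.map⁺ (All.tabulate appendFree-wf))
                           (All.map⁺ (All.tabulate (appendNew-wf ∘ ∈-upTo⁻)))

levelStates-wf : ∀ n → All (WellFormed n) (levelStates n)
levelStates-wf zero = root-wf ∷ []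
  where
  root-wf : WellFormed 0 (state [] 0 [])
  root-wf = record
    { below = [] ; dominated = λ () ; bound≤n = z≤n ; unique = []
    ; ∈-free = mk⇔ (λ ()) (λ ()) }
levelStates-wf (suc n) = All.concat⁺ (All.map⁺ (All.map childStates-wf (levelStates-wf n)))

label : ℕ → State → Label
label n s = (suc n ∸ bound s , length (free s))

map-≡-replicate : ∀ {A B : Set} {f : A → B} {c} {xs} → All (λ x → f x ≡ c) xs →
                  map f xs ≡ replicate (length xs) c
map-≡-replicate []           = refl
map-≡-replicate (fx≡c ∷ fxs) = cong₂ _∷_ fx≡c (map-≡-replicate fxs)

label-childStates : ∀ {n s} → WellFormed n s → map (label (suc n)) (childStates n s) ≡ children (label n s)
label-childStates {n} {s} wf = begin
  map (label (suc n)) (childStates n s)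
    ≡⟨ map-++ (label (suc n)) (map (appendFree s) (free s)) _ ⟩
  map (label (suc n)) (map (appendFree s) (free s)) ++ map (label (suc n)) (map (appendNew s) (upTo a))
    ≡⟨ cong₂ _++_ (trans (sym (map-∘ (free s))) (map-≡-replicate (All.tabulate appendFree-label)))
                  (trans (sym (map-∘ (upTo a))) (trans (map-cong appendNew-label (upTo a)) (map-∘ (upTo a)))) ⟩
  children (label n s) ∎
  where
  open ≡-Reasoning
  open WellFormed wf
  a = suc n ∸ bound s
  b = length (free s)

  appendFree-label : ∀ {x} → x ∈ free s → label (suc n) (appendFree s x) ≡ (suc a , b ∸ 1)
  appendFree-label x∈ = cong₂ _,_ (+-∸-assoc 1 (m≤n⇒m≤1+n bound≤n)) (cong (_∸ 1) (length-remove unique x∈))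

  appendNew-label : ∀ j → label (suc n) (appendNew s j) ≡ (suc a ∸ suc j , b + suc j)
  appendNew-label j = cong₂ _,_ (sym (∸-+-assoc (suc n) (bound s) j))
    (trans (length-++ (free s)) (cong (b +_) (length-interval (bound s) (suc j))))

label-levelStates : ∀ n → map (label n) (levelStates n) ≡ level n
label-levelStates zero    = refl
label-levelStates (suc n) = begin
  map (label (suc n)) (concatMap (childStates n) (levelStates n))
    ≡⟨ map-concatMap (label (suc n)) (childStates n) (levelStates n) ⟩
  concatMap (map (label (suc n)) ∘ childStates n) (levelStates n)
    ≡⟨ cong concat (map-cong-local (All.map label-childStates (levelStates-wf n))) ⟩
  concatMap (children ∘ label n) (levelStates n)
    ≡⟨ concatMap-map children (label n) (levelStates n) ⟨
  concatMap children (map (label n) (levelStates n))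
    ≡⟨ cong (concatMap children) (label-levelStates n) ⟩
  level (suc n) ∎
  where open ≡-Reasoning

options : ℕ → State → List ℕ
options n s = free s ++ interval (bound s) (suc n ∸ bound s)

extensions : ℕ → State → List (List ℕ)
extensions n s = map (seq s ∷ʳ_) (options n s)

sequences : ℕ → List (List ℕ)
sequences n = map seq (levelStates n)

sequences-suc : ∀ n → sequences (suc n) ≡ concatMap (extensions n) (levelStates n)
sequences-suc n = trans (map-concatMap seq (childStates n) (levelStates n))
                        (concatMap-cong seq-childStates (levelStates n))
  where
  seq-childStates : ∀ s → map seq (childStates n s) ≡ extensions n s
  seq-childStates s = begin
    map seq (childStates n s)
      ≡⟨ map-++ seq (map (appendFree s) (free s)) _ ⟩
    map seq (map (appendFree s) (free s)) ++ map seq (map (appendNew s) (upTo (suc n ∸ bound s)))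
      ≡⟨ cong₂ _++_ (sym (map-∘ (free s))) (trans (sym (map-∘ _)) (map-∘ _)) ⟩
    map (seq s ∷ʳ_) (free s) ++ map (seq s ∷ʳ_) (interval (bound s) (suc n ∸ bound s))
      ≡⟨ map-++ (seq s ∷ʳ_) (free s) _ ⟨
    extensions n s ∎
    where open ≡-Reasoning

∈-options : ∀ {n s x} → WellFormed n s → x ∈ options n s ⇔ (x < suc n × ¬ Completes (seq s) x)
∈-options {n} {s} {x} wf = mk⇔ ∈-options⇒ ⇒∈-options
  where
  open WellFormed wf
  bound≤n+1 = m≤n⇒m≤1+n bound≤n

  ∈-options⇒ : x ∈ options n s → x < suc n × ¬ Completes (seq s) x
  ∈-options⇒ x∈ with ∈-++⁻ (free s) x∈
  ... | inj₁ x∈free = let x<bound , ¬completes = to ∈-free x∈free in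
    <-≤-trans x<bound bound≤n+1 , ¬completes
  ... | inj₂ x∈interval = let bound≤x , x< = ∈-interval⁻ x∈interval in
    subst (x <_) (m+[n∸m]≡n bound≤n+1) x< , λ c → <⇒≱ (Completes⇒< below c) bound≤x

  ⇒∈-options : x < suc n × ¬ Completes (seq s) x → x ∈ options n s
  ⇒∈-options (x<n+1 , ¬completes) with x <? bound s
  ... | yes x<bound = ∈-++⁺ˡ (from ∈-free (x<bound , ¬completes))
  ... | no  x≮bound = ∈-++⁺ʳ (free s) (∈-interval⁺ (≮⇒≥ x≮bound)
                                (subst (x <_) (sym (m+[n∸m]≡n bound≤n+1)) x<n+1))

sequences-sound : ∀ n {σ} → σ ∈ sequences n → Good n σ
sequences-sound zero    (here refl) = (refl , λ ()) , λ ()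
sequences-sound (suc n) σ∈
  with s , s∈ , σ∈ext ← find (∈-concatMap⁻ (extensions n) (subst (_ ∈_) (sequences-suc n) σ∈))
  with x , x∈ , refl ← ∈-map⁻ (seq s ∷ʳ_) σ∈ext
  = from (Good-∷ʳ n (seq s) x)
      (sequences-sound n (∈-map⁺ seq s∈) , to (∈-options (All.lookup (levelStates-wf n) s∈)) x∈)

sequences-complete : ∀ n σ → Good n σ → σ ∈ sequences n
sequences-complete zero    []      _ = here refl
sequences-complete zero    (_ ∷ _) ((() , _) , _)
sequences-complete (suc n) σ good with initLast σ
sequences-complete (suc n) .[] ((() , _) , _) | []
sequences-complete (suc n) .(τ ∷ʳ x) good | τ ∷ʳ′ x
  with goodτ , x<n+1 , ¬completes ← to (Good-∷ʳ n τ x) good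
  with s , s∈ , refl ← ∈-map⁻ seq (sequences-complete n τ goodτ)
  = subst (_ ∈_) (sym (sequences-suc n)) (∈-concatMap⁺ (extensions n)
      (lose s∈ (∈-map⁺ (seq s ∷ʳ_) (from (∈-options (All.lookup (levelStates-wf n) s∈)) (x<n+1 , ¬completes)))))

sequences-unique : ∀ n → Unique (sequences n)
sequences-unique zero    = [] ∷ []
sequences-unique (suc n) = subst Unique (sym (sequences-suc n))
  (Unique.concat⁺ (All.map⁺ (All.map extensions-unique (levelStates-wf n)))
                  (AllPairs.map⁺ (AllPairs.map (λ {s} {s′} → extensions-disjoint {s} {s′}) (AllPairs.map⁻ (sequences-unique n)))))
  where
  extensions-unique : ∀ {s} → WellFormed n s → Unique (extensions n s)
  extensions-unique {s} wf = Unique.map⁺ (proj₂ ∘ ∷ʳ-injective (seq s) (seq s))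
    (Unique.++⁺ (WellFormed.unique wf) (interval-unique _ _) (free-interval-disjoint wf _))

  extensions-disjoint : ∀ {s s′} → seq s ≢ seq s′ → Disjoint (extensions n s) (extensions n s′)
  extensions-disjoint {s} {s′} seq≢ (σ∈ , σ∈′)
    with _ , _ , refl ← ∈-map⁻ (seq s ∷ʳ_) σ∈
    with _ , _ , eq ← ∈-map⁻ (seq s′ ∷ʳ_) σ∈′
    = seq≢ (proj₁ (∷ʳ-injective (seq s) (seq s′) eq))

theorem1 : (n : ℕ) →
    Σ (List (List ℕ)) λ L →
      Unique L ×
      (∀ σ → (σ ∈ L) ⇔ InI-000-100 n σ) ×
      (length (level n) ≡ length L)
theorem1 n =
  sequences n ,
  sequences-unique n ,
  (λ σ → mk⇔ (from (InI⇔Good n σ) ∘ sequences-sound n) (sequences-complete n σ ∘ to (InI⇔Good n σ))) ,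
  (begin
    length (level n)                      ≡⟨ cong length (label-levelStates n) ⟨
    length (map (label n) (levelStates n)) ≡⟨ length-map (label n) (levelStates n) ⟩
    length (levelStates n)                ≡⟨ length-map seq (levelStates n) ⟨
    length (sequences n)                  ∎)
  where open ≡-Reasoning
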